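{- Let $\langle X,\tau^0,\tau^1\rangle$ be a $\mathbf{CL}$-space. The following are equivalent: (1) $\langle X,\tau^0,\tau^1\rangle$ is an $\mathbf{IL}$-space; (2) for every $U\in\tau^1$ and every $Y\subseteq X$, $d_{\tau^0}(d_{\tau^0}(Y)\cap U)\subseteq d_{\tau^0}(Y\cap U)$; (3) for every $U\in\tau^1$, $d_{\tau^0}(d_{\tau^0}(X\setminus U)\cap U)=\varnothing$; (4) for every $U\in\tau^1$ there exists $V\in\tau^0$ with $V\subseteq U$ and $d_{\tau^0}(U\setminus V)=\varnothing$.
   Context: $\mathcal{L}(\Box,\rhd)$ has propositional variables, $\top,\bot$, $\neg,\land,\lor,\to$, unary $\Box,\Diamond$ ($\Diamond$ dual of $\Box$) and binary $\rhd$. $\mathbf{CL}$ is the smallest set of formulas containing all propositional tautologies, $\Box(p\to q)\to(\Box p\to\Box q)$, $\Box(\Box p\to p)\to\Box p$, J1: $\Box(p\to q)\to(p\rhd q)$; J2: $(p\rhd q)\land(q\rhd r)\to(p\rhd r)$; J3: $(p\rhd r)\land(q\rhd r)\to((p\lor q)\rhd r)$; J4: $(p\rhd q)\to(\Diamond p\to\Diamond q)$, closed under modus ponens, necessitation and substitution; $\mathbf{IL}$ is the smallest such set also containing J5: $\Diamond p\rhd p$. For a topology $\tau$, $d_\tau(Y)=\{x: \text{every } U\in\tau \text{ containing } x \text{ meets } Y\setminus\{x\}\}$, $cd_\tau(Y)=X\setminus d_\tau(X\setminus Y)$. A bitopological space is $\langle X,\tau^0,\tau^1\rangle$ with $X\ne\varnothing$,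 $\tau^0,\tau^1$ topologies. $e_{\tau^0,\tau^1}(Y,Z)=\{x:\forall U\in\tau^1[x\in d_{\tau^0}(Y\cap U)\Rightarrow x\in d_{\tau^0}(Z\cap U)]\}$. A valuation $v$ maps formulas to subsets of $X$, Boolean on connectives, with $v(\Box\varphi)=cd_{\tau^0}(v(\varphi))$, $v(\Diamond\varphi)=d_{\tau^0}(v(\varphi))$, $v(\varphi\rhd\psi)=e_{\tau^0,\tau^1}(v(\varphi),v(\psi))$. $\mathrm{Log}(X,\tau^0,\tau^1)$ is the set of $\varphi$ with $v(\varphi)=X$ for all $v$. For a logic $L$, an $L$-space is a bitopological space with $L\subseteq\mathrm{Log}(X,\tau^0,\tau^1)$. -}

module Defs where

open import Data.Nat using (ℕ)
open import Data.Bool using (Bool; true; false; _∧_; _∨_; not)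
open import Data.Empty using (⊥)
open import Data.Unit using (⊤)
open import Data.Product using (Σ; ∃; _×_; _,_)
open import Data.Sum using (_⊎_)
open import Relation.Nullary using (¬_)
open import Relation.Binary.PropositionalEquality using (_≡_; _≢_)

Subset : Set → Set₁
Subset X = X → Set

-- A topology on X is presented by an index set I of open
-- sets together with the decoding O : I → Subset X.  (Every topology
-- τ ⊆ P(X) is presented by I = τ, O = id.)  Equality of subsets is
-- extensional (pointwise ↔).

record Topology (X : Set) : Set₁ where
  field
    Idx  : Set
    Open : Idx → Subset X
    whole : Σ Idx λ i → ∀ x → Open i x
    inter : ∀ i j → Σ Idx λ k → ∀ x →
              (Open k x → Open i x × Open j x) × (Open i x × Open j x → Open k x)
    -- arbitrary unions (indexed by any J : Set) are open;
    -- the empty union gives that ∅ is open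
    union : (J : Set) (f : J → Idx) → Σ Idx λ k → ∀ x →
              (Open k x → Σ J λ j → Open (f j) x) × (Σ J (λ j → Open (f j) x) → Open k x)

module _ {X : Set} where
  open Topology

  d : Topology X → Subset X → Subset X
  d τ Y x = ∀ (i : Idx τ) → Open τ i x → Σ X λ y → Y y × Open τ i y × y ≢ x

  cd : Topology X → Subset X → Subset X
  cd τ Y x = ¬ d τ (λ y → ¬ Y y) x

record BiTop : Set₁ where
  field
    X    : Set
    pt   : X
    τ⁰   : Topology X
    τ¹   : Topology X

module _ (B : BiTop) where
  open BiTop B
  open Topology

  e : Subset X → Subset X → Subset X
  e Y Z x = ∀ (i : Idx τ¹) →
              d τ⁰ (λ y → Y y × Open τ¹ i y) x → d τ⁰ (λ y → Z y × Open τ¹ i y) x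

infixr 4 _⇒_
infixr 5 _∨ᶠ_
infixr 6 _∧ᶠ_
infix 7 _▷_

data Fm : Set where
  var   : ℕ → Fm
  ⊤ᶠ ⊥ᶠ : Fm
  ¬ᶠ_   : Fm → Fm
  _∧ᶠ_ _∨ᶠ_ _⇒_ : Fm → Fm → Fm
  □ ◇   : Fm → Fm
  _▷_   : Fm → Fm → Fm

sub : (ℕ → Fm) → Fm → Fm
sub σ (var n) = σ n
sub σ ⊤ᶠ = ⊤ᶠ
sub σ ⊥ᶠ = ⊥ᶠ
sub σ (¬ᶠ φ) = ¬ᶠ sub σ φ
sub σ (φ ∧ᶠ ψ) = sub σ φ ∧ᶠ sub σ ψ
sub σ (φ ∨ᶠ ψ) = sub σ φ ∨ᶠ sub σ ψ
sub σ (φ ⇒ ψ) = sub σ φ ⇒ sub σ ψ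
sub σ (□ φ) = □ (sub σ φ)
sub σ (◇ φ) = ◇ (sub σ φ)
sub σ (φ ▷ ψ) = sub σ φ ▷ sub σ ψ

beval : (Fm → Bool) → Fm → Bool
beval g (var n) = g (var n)
beval g ⊤ᶠ = true
beval g ⊥ᶠ = false
beval g (¬ᶠ φ) = not (beval g φ)
beval g (φ ∧ᶠ ψ) = beval g φ ∧ beval g ψ
beval g (φ ∨ᶠ ψ) = beval g φ ∨ beval g ψ
beval g (φ ⇒ ψ) = not (beval g φ) ∨ beval g ψ
beval g (□ φ) = g (□ φ)
beval g (◇ φ) = g (◇ φ)
beval g (φ ▷ ψ) = g (φ ▷ ψ)

Taut : Fm → Set
Taut φ = ∀ (g : Fm → Bool) → beval g φ ≡ true

p q r : Fm
p = var 0
q = var 1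
r = var 2

axK axL J1 J2 J3 J4 J5 : Fm
axK = □ (p ⇒ q) ⇒ (□ p ⇒ □ q)
axL = □ (□ p ⇒ p) ⇒ □ p
J1 = □ (p ⇒ q) ⇒ (p ▷ q)
J2 = (p ▷ q) ∧ᶠ (q ▷ r) ⇒ (p ▷ r)
J3 = (p ▷ r) ∧ᶠ (q ▷ r) ⇒ ((p ∨ᶠ q) ▷ r)
J4 = (p ▷ q) ⇒ (◇ p ⇒ ◇ q)
J5 = ◇ p ▷ p

data Deriv (Extra : Fm → Set) : Fm → Set where
  taut : ∀ {φ} → Taut φ → Deriv Extra φ
  aK   : Deriv Extra axK
  aL   : Deriv Extra axL
  aJ1  : Deriv Extra J1
  aJ2  : Deriv Extra J2
  aJ3  : Deriv Extra J3
  aJ4  : Deriv Extra J4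
  extra : ∀ {φ} → Extra φ → Deriv Extra φ
  mp   : ∀ {φ ψ} → Deriv Extra (φ ⇒ ψ) → Deriv Extra φ → Deriv Extra ψ
  nec  : ∀ {φ} → Deriv Extra φ → Deriv Extra (□ φ)
  subst : ∀ {φ} (σ : ℕ → Fm) → Deriv Extra φ → Deriv Extra (sub σ φ)

CL : Fm → Set
CL = Deriv (λ _ → ⊥)

IL : Fm → Set
IL = Deriv (λ φ → φ ≡ J5)

module _ (B : BiTop) where
  open BiTop B

  ⟦_⟧ : Fm → (ℕ → Subset X) → Subset X
  ⟦ var n ⟧ v x = v n x
  ⟦ ⊤ᶠ ⟧ v x = ⊤
  ⟦ ⊥ᶠ ⟧ v x = ⊥
  ⟦ ¬ᶠ φ ⟧ v x = ¬ ⟦ φ ⟧ v x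
  ⟦ φ ∧ᶠ ψ ⟧ v x = ⟦ φ ⟧ v x × ⟦ ψ ⟧ v x
  ⟦ φ ∨ᶠ ψ ⟧ v x = ⟦ φ ⟧ v x ⊎ ⟦ ψ ⟧ v x
  ⟦ φ ⇒ ψ ⟧ v x = ⟦ φ ⟧ v x → ⟦ ψ ⟧ v x
  ⟦ □ φ ⟧ v x = cd τ⁰ (⟦ φ ⟧ v) x
  ⟦ ◇ φ ⟧ v x = d τ⁰ (⟦ φ ⟧ v) x
  ⟦ φ ▷ ψ ⟧ v x = e B (⟦ φ ⟧ v) (⟦ ψ ⟧ v) x

  Valid : Fm → Set₁
  Valid φ = ∀ (v : ℕ → Subset X) (x : X) → ⟦ φ ⟧ v x

  IsSpace : (Fm → Set) → Set₁
  IsSpace L = ∀ φ → L φ → Valid φ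

module _ (B : BiTop) where
  open BiTop B
  open Topology

  Cond2 : Set₁
  Cond2 = ∀ (i : Idx τ¹) (Y : Subset X) (x : X) →
            d τ⁰ (λ y → d τ⁰ Y y × Open τ¹ i y) x → d τ⁰ (λ y → Y y × Open τ¹ i y) x

  Cond3 : Set
  Cond3 = ∀ (i : Idx τ¹) (x : X) →
            ¬ d τ⁰ (λ y → d τ⁰ (λ z → ¬ Open τ¹ i z) y × Open τ¹ i y) x

  Cond4 : Set
  Cond4 = ∀ (i : Idx τ¹) → Σ (Idx τ⁰) λ j →
            (∀ x → Open τ⁰ j x → Open τ¹ i x) ×
            (∀ x → ¬ d τ⁰ (λ y → Open τ¹ i y × ¬ Open τ⁰ j y) x)

{-# OPTIONS --safe #-}
-- A CL-space is classical (p ∨ ¬ p is valid), and validity of Löb's axiom makes the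
-- derived-set operator d of τ⁰ scattered: d Z ⊆ d (Z ∖ d Z), whence d (d Y) ⊆ d Y.
-- Validity of J5 is literally condition (2), and with the CL axioms it gives all of IL.
-- (2) ⇒ (3) takes Y = X ∖ U; (3) ⇒ (4) takes V the τ⁰-interior of U; for (4) ⇒ (2),
-- near x the set d Y ∩ U lies in the τ⁰-open V, where d Y ∩ V ⊆ d (Y ∩ V), and then
-- d (d (Y ∩ V)) ⊆ d (Y ∩ V) ⊆ d (Y ∩ U).
module Submission where

open import Defs
open import Data.Bool using (true; false)
open import Data.Empty using (⊥-elim)
open import Data.Nat using (ℕ)
open import Data.Product using (Σ; _×_; _,_; proj₁; proj₂; map₁; map₂)
open import Data.Product.Function.NonDependent.Propositional using (_×-⇔_)
open import Data.Sum using (_⊎_; inj₁; inj₂)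
open import Data.Sum.Function.Propositional using (_⊎-⇔_)
open import Function using (_∘_)
open import Function.Bundles using (_⇔_; mk⇔; Equivalence)
open import Function.Construct.Composition using (_⇔-∘_)
open import Function.Construct.Identity using (⇔-id)
open import Function.Related.TypeIsomorphisms using (→-cong-⇔; ¬-cong-⇔)
open import Relation.Binary.PropositionalEquality using (refl; _≢_)
open import Relation.Nullary using (¬_)
open import Relation.Unary using (_⊆_; _∩_; _∪_; ∁; Empty)

open Equivalence using (to; from)

module _ {X : Set} (τ : Topology X) where
  open Topology τ

  d-mono : {Y Z : Subset X} → Y ⊆ Z → d τ Y ⊆ d τ Z
  d-mono Y⊆Z x∈dY i x∈i with x∈dY i x∈i
  ... | y , y∈Y , y∈i , y≢x = y , Y⊆Z y∈Y , y∈i , y≢x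

  d-cong : {Y Z : Subset X} → (∀ x → Y x ⇔ Z x) → ∀ x → d τ Y x ⇔ d τ Z x
  d-cong Y⇔Z x = mk⇔ (d-mono (to (Y⇔Z _))) (d-mono (from (Y⇔Z _)))

  d-empty : {Y : Subset X} → Empty Y → Empty (d τ Y)
  d-empty Y-empty x x∈dY with whole
  ... | i , i-whole with x∈dY i (i-whole x)
  ... | y , y∈Y , _ = Y-empty y y∈Y

  d-∩-open : {Y : Subset X} (j : Idx) → d τ Y ∩ Open j ⊆ d τ (Y ∩ Open j)
  d-∩-open j (x∈dY , x∈j) i x∈i with inter i j
  ... | k , k≐i∩j with x∈dY k (proj₂ (k≐i∩j _) (x∈i , x∈j))
  ... | y , y∈Y , y∈k , y≢x with proj₁ (k≐i∩j y) y∈k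
  ... | y∈i , y∈j = y , (y∈Y , y∈j) , y∈i , y≢x

  interior : Subset X → Idx
  interior U = proj₁ (union (Σ Idx λ j → Open j ⊆ U) proj₁)

  interior-⊆ : (U : Subset X) → Open (interior U) ⊆ U
  interior-⊆ U x∈int with proj₁ (proj₂ (union (Σ Idx λ j → Open j ⊆ U) proj₁) _) x∈int
  ... | (j , j⊆U) , x∈j = j⊆U x∈j

  open-⊆-interior : (U : Subset X) (j : Idx) → Open j ⊆ U → Open j ⊆ Open (interior U)
  open-⊆-interior U j j⊆U x∈j =
    proj₂ (proj₂ (union (Σ Idx λ j → Open j ⊆ U) proj₁) _) ((j , j⊆U) , x∈j)

  module Classical (em : (P : Set) → P ⊎ ¬ P) where

    dne : {P : Set} → ¬ ¬ P → P
    dne {P} ¬¬p with em P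
    ... | inj₁ p = p
    ... | inj₂ ¬p = ⊥-elim (¬¬p ¬p)

    ∉d⇒isolating-nbhd : {Y : Subset X} {x : X} → ¬ d τ Y x →
      Σ Idx λ i → Open i x × ¬ (Σ X λ y → Y y × Open i y × y ≢ x)
    ∉d⇒isolating-nbhd x∉dY =
      dne λ no-nbhd → x∉dY λ i x∈i → dne λ i-isolates → no-nbhd (i , x∈i , i-isolates)

    d-split : {A B : Subset X} {x : X} → d τ A x → ¬ d τ (A ∩ ∁ B) x → d τ (A ∩ B) x
    d-split {B = B} x∈dA x∉dA∖B i x∈i with ∉d⇒isolating-nbhd x∉dA∖B
    ... | w , x∈w , w-isolates with inter i w
    ... | k , k≐i∩w with x∈dA k (proj₂ (k≐i∩w _) (x∈i , x∈w))
    ... | y , y∈A , y∈k , y≢x with proj₁ (k≐i∩w y) y∈k | em (B y)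
    ... | y∈i , _   | inj₁ y∈B = y , (y∈A , y∈B) , y∈i , y≢x
    ... | _   , y∈w | inj₂ y∉B = ⊥-elim (w-isolates (y , (y∈A , y∉B) , y∈w , y≢x))

    ∉d∁⇒interior : {U : Subset X} {x : X} → U x → ¬ d τ (∁ U) x → Open (interior U) x
    ∉d∁⇒interior {U} {x} x∈U x∉d∁U with ∉d⇒isolating-nbhd x∉d∁U
    ... | w , x∈w , w-isolates = open-⊆-interior U w w⊆U x∈w
      where
        w⊆U : Open w ⊆ U
        w⊆U {y} y∈w = dne λ y∉U → w-isolates (y , y∉U , y∈w , λ { refl → y∉U x∈U })

module _ (B : BiTop) where
  open BiTop B
  open Topology

  private
    ⟦_⟧ᴮ : Fm → (ℕ → Subset X) → Subset X
    ⟦_⟧ᴮ = ⟦_⟧ B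

  e-cong : {Y Y′ Z Z′ : Subset X} → (∀ x → Y x ⇔ Y′ x) → (∀ x → Z x ⇔ Z′ x) →
           ∀ x → e B Y Z x ⇔ e B Y′ Z′ x
  e-cong Y⇔Y′ Z⇔Z′ x = mk⇔
    (λ h i → d-mono τ⁰ (map₁ (to (Z⇔Z′ _))) ∘ h i ∘ d-mono τ⁰ (map₁ (from (Y⇔Y′ _))))
    (λ h i → d-mono τ⁰ (map₁ (from (Z⇔Z′ _))) ∘ h i ∘ d-mono τ⁰ (map₁ (to (Y⇔Y′ _))))

  ⟦sub⟧ : ∀ σ φ (v : ℕ → Subset X) x → ⟦ sub σ φ ⟧ᴮ v x ⇔ ⟦ φ ⟧ᴮ (λ n → ⟦ σ n ⟧ᴮ v) x
  ⟦sub⟧ σ (var n) v x = ⇔-id _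
  ⟦sub⟧ σ ⊤ᶠ v x = ⇔-id _
  ⟦sub⟧ σ ⊥ᶠ v x = ⇔-id _
  ⟦sub⟧ σ (¬ᶠ φ) v x = ¬-cong-⇔ (⟦sub⟧ σ φ v x)
  ⟦sub⟧ σ (φ ∧ᶠ ψ) v x = ⟦sub⟧ σ φ v x ×-⇔ ⟦sub⟧ σ ψ v x
  ⟦sub⟧ σ (φ ∨ᶠ ψ) v x = ⟦sub⟧ σ φ v x ⊎-⇔ ⟦sub⟧ σ ψ v x
  ⟦sub⟧ σ (φ ⇒ ψ) v x = →-cong-⇔ (⟦sub⟧ σ φ v x) (⟦sub⟧ σ ψ v x)
  ⟦sub⟧ σ (□ φ) v x = ¬-cong-⇔ (d-cong τ⁰ (λ y → ¬-cong-⇔ (⟦sub⟧ σ φ v y)) x)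
  ⟦sub⟧ σ (◇ φ) v x = d-cong τ⁰ (⟦sub⟧ σ φ v) x
  ⟦sub⟧ σ (φ ▷ ψ) v x = e-cong (⟦sub⟧ σ φ v) (⟦sub⟧ σ ψ v) x

  valid-sub : ∀ σ {φ} → Valid B φ → Valid B (sub σ φ)
  valid-sub σ {φ} ⊨φ v x = from (⟦sub⟧ σ φ v x) (⊨φ _ x)

  valid-□ : ∀ {φ} → Valid B φ → Valid B (□ φ)
  valid-□ ⊨φ v = d-empty τ⁰ λ y y∉φ → y∉φ (⊨φ v y)

  valid-J5⇔Cond2 : Valid B J5 ⇔ Cond2 B
  valid-J5⇔Cond2 = mk⇔ (λ ⊨J5 i Y x → ⊨J5 (λ _ → Y) x i) (λ c2 v x i → c2 i (v 0) x)

  Cond2⇒Cond3 : Cond2 B → Cond3 B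
  Cond2⇒Cond3 c2 i x x∈dd∁U∩U =
    d-empty τ⁰ (λ y (y∉U , y∈U) → y∉U y∈U) x (c2 i (∁ (Open τ¹ i)) x x∈dd∁U∩U)

module CLSpace (B : BiTop) (CL-space : IsSpace B CL) where
  open BiTop B
  open Topology

  -- The connectives are interpreted intuitionistically, so the validity of p ∨ ¬ p
  -- under the constant valuation P is excluded middle for P.
  excluded-middle : (P : Set) → P ⊎ ¬ P
  excluded-middle P = CL-space (p ∨ᶠ ¬ᶠ p) (taut p∨¬p) (λ _ _ → P) pt
    where
      p∨¬p : Taut (p ∨ᶠ ¬ᶠ p)
      p∨¬p g with g p
      ... | true = refl
      ... | false = refl

  open Classical τ⁰ excluded-middle

  IL-sound : Valid B J5 → IsSpace B IL
  IL-sound ⊨J5 φ (taut t) = CL-space φ (taut t)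
  IL-sound ⊨J5 _ aK = CL-space _ aK
  IL-sound ⊨J5 _ aL = CL-space _ aL
  IL-sound ⊨J5 _ aJ1 = CL-space _ aJ1
  IL-sound ⊨J5 _ aJ2 = CL-space _ aJ2
  IL-sound ⊨J5 _ aJ3 = CL-space _ aJ3
  IL-sound ⊨J5 _ aJ4 = CL-space _ aJ4
  IL-sound ⊨J5 _ (extra refl) = ⊨J5
  IL-sound ⊨J5 ψ (mp {φ} ⊢φ⇒ψ ⊢φ) v x = IL-sound ⊨J5 (φ ⇒ ψ) ⊢φ⇒ψ v x (IL-sound ⊨J5 φ ⊢φ v x)
  IL-sound ⊨J5 _ (nec {φ} ⊢φ) = valid-□ B {φ} (IL-sound ⊨J5 φ ⊢φ)
  IL-sound ⊨J5 _ (subst {φ} σ ⊢φ) = valid-sub B σ {φ} (IL-sound ⊨J5 φ ⊢φ)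

  IL-space⇔Cond2 : IsSpace B IL ⇔ Cond2 B
  IL-space⇔Cond2 = valid-J5⇔Cond2 B ⇔-∘ mk⇔ (λ IL-space → IL-space J5 (extra refl)) IL-sound

  -- Löb's axiom under the valuation p ↦ X ∖ Z.
  d-scattered : (Z : Subset X) → d τ⁰ Z ⊆ d τ⁰ (Z ∩ ∁ (d τ⁰ Z))
  d-scattered Z {x} x∈dZ = dne λ x∉d →
    CL-space axL aL (λ _ → ∁ Z) x (x∉d ∘ d-mono τ⁰ premise⊆) (d-mono τ⁰ ¬¬-intro x∈dZ)
    where
      ¬¬-intro : Z ⊆ ∁ (∁ Z)
      ¬¬-intro z∈Z z∉Z = z∉Z z∈Z
      premise⊆ : (λ y → ¬ (cd τ⁰ (∁ Z) y → ¬ Z y)) ⊆ Z ∩ ∁ (d τ⁰ Z)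
      premise⊆ h = dne (λ y∉Z → h λ _ → y∉Z) , λ y∈dZ → h λ y∈cd _ → y∈cd (d-mono τ⁰ ¬¬-intro y∈dZ)

  d-d⊆d : (Y : Subset X) → d τ⁰ (d τ⁰ Y) ⊆ d τ⁰ Y
  d-d⊆d Y x∈ddY = d-mono τ⁰ isolated⊆Y (d-scattered (Y ∪ d τ⁰ Y) (d-mono τ⁰ inj₂ x∈ddY))
    where
      isolated⊆Y : (Y ∪ d τ⁰ Y) ∩ ∁ (d τ⁰ (Y ∪ d τ⁰ Y)) ⊆ Y
      isolated⊆Y (inj₁ y∈Y , _) = y∈Y
      isolated⊆Y (inj₂ y∈dY , y∉d) = ⊥-elim (y∉d (d-mono τ⁰ inj₁ y∈dY))

  Cond3⇒Cond4 : Cond3 B → Cond4 B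
  Cond3⇒Cond4 c3 i = interior τ⁰ U , (λ _ → interior-⊆ τ⁰ U) , λ x → c3 i x ∘ d-mono τ⁰ U∖V⊆
    where
      U : Subset X
      U = Open τ¹ i
      U∖V⊆ : U ∩ ∁ (Open τ⁰ (interior τ⁰ U)) ⊆ d τ⁰ (∁ U) ∩ U
      U∖V⊆ (y∈U , y∉V) = dne (y∉V ∘ ∉d∁⇒interior y∈U) , y∈U

  Cond4⇒Cond2 : Cond4 B → Cond2 B
  Cond4⇒Cond2 c4 i Y x x∈d[dY∩U] with c4 i
  ... | j , V⊆U , d[U∖V]-empty =
    d-mono τ⁰ (map₂ (V⊆U _)) (d-d⊆d (Y ∩ V) (d-mono τ⁰ (d-∩-open τ⁰ j) x∈d[dY∩V]))
    where
      V : Subset X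
      V = Open τ⁰ j
      x∈d[dY∩V] : d τ⁰ (d τ⁰ Y ∩ V) x
      x∈d[dY∩V] = d-mono τ⁰ (map₁ proj₁)
        (d-split x∈d[dY∩U] (d[U∖V]-empty x ∘ d-mono τ⁰ (map₁ proj₂)))

theorem5p1 : (B : BiTop) → IsSpace B CL →
    (IsSpace B IL ⇔ Cond2 B) × (IsSpace B IL ⇔ Cond3 B) × (IsSpace B IL ⇔ Cond4 B)
theorem5p1 B CL-space =
  IL-space⇔Cond2 ,
  mk⇔ (Cond2⇒Cond3 B) (Cond4⇒Cond2 ∘ Cond3⇒Cond4) ⇔-∘ IL-space⇔Cond2 ,
  mk⇔ (Cond3⇒Cond4 ∘ Cond2⇒Cond3 B) Cond4⇒Cond2 ⇔-∘ IL-space⇔Cond2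
  where open CLSpace B CL-space
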